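{- For every integer $b\ge 3$, there exists a numerical semigroup $S$ such that $\mathrm{B}(S)=\{2,3,\dots,b\}$.
   Context: $\mathbb N=\{0,1,2,\dots\}$. A numerical semigroup is a subset $S\subseteq\mathbb N$ containing $0$, closed under addition, with finite complement. For a finite set $A\subset\mathbb Z$ and $n\ge1$, $nA$ is the $n$-fold sumset: $1A=A$, $nA=A+(n-1)A$, where $X+Y=\{x+y\mid x\in X, y\in Y\}$. For a numerical semigroup $S$ with gapset $G=\mathbb N\setminus S$, its Buchweitz set is $\mathrm{B}(S)=\{n\ge 2 \mid |nG| > (2n-1)(|G|-1)\}$. -}

module Defs where

open import Data.Nat using (ℕ; zero; suc; _+_; _*_; _∸_; _≤_)
open import Data.Nat.Properties using (_≟_)
open import Data.List using (List; []; _∷_; map; concatMap; length; deduplicate)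
open import Data.List.Membership.Propositional using (_∈_)
open import Data.Product using (_×_)
open import Data.Integer as ℤ using (ℤ; +_)
open import Function.Bundles using (_⇔_)
open import Relation.Nullary using (¬_)

record NumericalSemigroup : Set₁ where
  field
    S         : ℕ → Set
    zero∈S    : S 0
    closed    : ∀ {x y} → S x → S y → S (x + y)
    gaps      : List ℕ
    gaps-spec : ∀ n → (¬ S n) ⇔ (n ∈ gaps)

card : List ℕ → ℕ
card xs = length (deduplicate _≟_ xs)

_⊕_ : List ℕ → List ℕ → List ℕ
X ⊕ Y = concatMap (λ x → map (λ y → x + y) Y) X

-- n-fold sumset: 1A = A, nA = A + (n-1)A.  (The n = 0 case is never used;
-- it is set to {0} for totality.)
_·_ : ℕ → List ℕ → List ℕ
zero · A = 0 ∷ []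
suc zero · A = A
suc (suc n) · A = A ⊕ (suc n · A)

InBuchweitz : NumericalSemigroup → ℕ → Set
InBuchweitz Σ n =
  2 ≤ n × ((+ (2 * n ∸ 1)) ℤ.* ((+ card G) ℤ.- (+ 1)) ℤ.< (+ card (n · G)))
  where G = NumericalSemigroup.gaps Σ

-- Take m = 6b + 2, F = 2m + 1 and G = {1, …, m} ∪ (F − T₀) with T₀ = {0, 1, 5, 7}; G is the gap
-- set of a numerical semigroup because two nonzero non-gaps both exceed m, so their sum exceeds F.
-- Since N·G ⊆ [N, NF], |N·G| ≤ 2mN + 1, which is at most (2N − 1)(|G| − 1) as soon as N > b.
-- For 2 ≤ N ≤ b, N·G contains the interval [N, (N − 1)F + m] (sums with one summand in {F − 1, F}
-- continue the interval obtained from the small gaps) and, above it, the mirror images NF − t of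
-- the sums t ∈ N·T₀ with t ≤ 6N + 2 ≤ m. There are at least 6N − 2 such t, so
-- |N·G| ≥ (2N − 1)(|G| − 1) + 1.
module Submission where

open import Defs
open import Data.Nat using (ℕ; zero; suc; _+_; _*_; _∸_; _≤_; _<_; z≤n; s≤s; s≤s⁻¹; _≤?_)
open import Data.Nat.Properties
open import Data.Nat.Tactic.RingSolver using (solve-∀)
import Data.Integer as ℤ
import Data.Integer.Properties as ℤ
open import Data.List using (List; []; _∷_; _++_; map; length; deduplicate; filter; applyUpTo; upTo)
open import Data.List.Properties using (length-++; length-map; length-applyUpTo; length-upTo)
open import Data.List.Membership.Propositional using (_∈_; _∉_; find; lose)
open import Data.List.Membership.Propositional.Properties
  using (∈-++⁺ˡ; ∈-++⁺ʳ; ∈-++⁻; ∈-map⁺; ∈-map⁻; ∈-concatMap⁺; ∈-concatMap⁻; ∈-applyUpTo⁺;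
         ∈-applyUpTo⁻; ∈-upTo⁺; ∈-upTo⁻; ∈-filter⁺; ∈-filter⁻; ∈-deduplicate⁺; ∈-deduplicate⁻; ∈-∃++)
open import Data.List.Membership.DecPropositional _≟_ using (_∈?_)
open import Data.List.Relation.Unary.Any using (here; there)
import Data.List.Relation.Unary.All as All
import Data.List.Relation.Unary.All.Properties as All
open import Data.List.Relation.Unary.Unique.Propositional using (Unique; []; _∷_)
open import Data.List.Relation.Unary.Unique.Propositional.Properties using (++⁺; filter⁺; applyUpTo⁺₁; upTo⁺)
open import Data.List.Relation.Unary.Unique.DecPropositional _≟_ using (unique?)
open import Data.List.Relation.Unary.Unique.DecPropositional.Properties _≟_ using (deduplicate-!)
open import Data.List.Relation.Binary.Disjoint.Propositional using (Disjoint)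
open import Data.Product using (Σ; ∃₂; _×_; _,_; proj₁; proj₂)
import Data.Product as Product
open import Data.Sum using (_⊎_; inj₁; inj₂)
open import Data.Empty using (⊥-elim)
open import Function using (_∘_; id)
open import Function.Bundles using (_⇔_; mk⇔)
open import Function.Construct.Composition using (_⇔-∘_)
open import Relation.Binary.PropositionalEquality using (_≡_; refl; sym; trans; cong; cong₂; subst)
open import Relation.Nullary using (yes; no)
open import Relation.Nullary.Decidable using (from-yes; decidable-stable)

open ≤-Reasoning

⊕⁺ : ∀ {X Y : List ℕ} {x y} → x ∈ X → y ∈ Y → x + y ∈ X ⊕ Y
⊕⁺ {Y = Y} {x} x∈X y∈Y = ∈-concatMap⁺ (λ x → map (x +_) Y) (lose x∈X (∈-map⁺ (x +_) y∈Y))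

⊕⁻ : ∀ X Y {z} → z ∈ X ⊕ Y → ∃₂ λ x y → x ∈ X × y ∈ Y × z ≡ x + y
⊕⁻ X Y z∈X⊕Y with find (∈-concatMap⁻ (λ x → map (x +_) Y) {xs = X} z∈X⊕Y)
... | x , x∈X , z∈x+Y with ∈-map⁻ (x +_) z∈x+Y
...   | y , y∈Y , z≡x+y = x , y , x∈X , y∈Y , z≡x+y

infix 4 _⊇[_,_]

_⊇[_,_] : List ℕ → ℕ → ℕ → Set
X ⊇[ lo , hi ] = ∀ {z} → lo ≤ z → z ≤ hi → z ∈ X

⊇[]-singleton : ∀ {X x} → x ∈ X → X ⊇[ x , x ]
⊇[]-singleton {X} x∈X x≤z z≤x = subst (_∈ X) (≤-antisym x≤z z≤x) x∈X

⊇[]-weakenʳ : ∀ {X lo hi hi′} → hi′ ≤ hi → X ⊇[ lo , hi ] → X ⊇[ lo , hi′ ]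
⊇[]-weakenʳ hi′≤hi X⊇ lo≤z z≤hi′ = X⊇ lo≤z (≤-trans z≤hi′ hi′≤hi)

⊇[]-join : ∀ {X a b c d} → c ≤ suc b → X ⊇[ a , b ] → X ⊇[ c , d ] → X ⊇[ a , d ]
⊇[]-join {b = b} c≤1+b X⊇ab X⊇cd {z} a≤z z≤d with z ≤? b
... | yes z≤b = X⊇ab a≤z z≤b
... | no  z≰b = X⊇cd (≤-trans c≤1+b (≰⇒> z≰b)) z≤d

⊕-⊇[] : ∀ {X Y a b c d} → a ≤ b → c ≤ d → X ⊇[ a , b ] → Y ⊇[ c , d ] → X ⊕ Y ⊇[ a + c , b + d ]
⊕-⊇[] {a = a} {b} {c} {d} a≤b c≤d X⊇ Y⊇ {z} a+c≤z z≤b+d with z ≤? b + c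
... | yes z≤b+c = subst (_∈ _) (m∸n+n≡m c≤z)
  (⊕⁺ (X⊇ (m+n≤o⇒m≤o∸n a a+c≤z) (m≤n+o⇒m∸n≤o z c (subst (z ≤_) (+-comm b c) z≤b+c))) (Y⊇ ≤-refl c≤d))
  where c≤z = ≤-trans (m≤n+m c a) a+c≤z
... | no  z≰b+c = subst (_∈ _) (m+[n∸m]≡n b≤z)
  (⊕⁺ (X⊇ a≤b ≤-refl) (Y⊇ (m+n≤o⇒m≤o∸n c (subst (_≤ z) (+-comm b c) b+c≤z)) (m≤n+o⇒m∸n≤o z b z≤b+d)))
  where
  b+c≤z = <⇒≤ (≰⇒> z≰b+c)
  b≤z = ≤-trans (m≤m+n b c) b+c≤z

range : ℕ → ℕ → List ℕ
range lo k = applyUpTo (lo +_) k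

∈-range⁺ : ∀ {lo k z} → lo ≤ z → z < lo + k → z ∈ range lo k
∈-range⁺ {lo} {k} {z} lo≤z z<lo+k with z ∸ lo | m+[n∸m]≡n lo≤z
... | d | refl = ∈-applyUpTo⁺ (lo +_) (+-cancelˡ-< lo d k z<lo+k)

∈-range⁻ : ∀ {lo k z} → z ∈ range lo k → lo ≤ z × z < lo + k
∈-range⁻ {lo} z∈range with ∈-applyUpTo⁻ (lo +_) z∈range
... | i , i<k , refl = m≤m+n lo i , +-monoʳ-< lo i<k

range-unique : ∀ lo k → Unique (range lo k)
range-unique lo k = applyUpTo⁺₁ (lo +_) k (λ i<j _ → <⇒≢ (+-monoʳ-< lo i<j))

range-⊆ : ∀ {X lo hi k} → X ⊇[ lo , hi ] → lo + k ≤ suc hi → ∀ {z} → z ∈ range lo k → z ∈ X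
range-⊆ X⊇ lo+k≤1+hi z∈range with ∈-range⁻ z∈range
... | lo≤z , z<lo+k = X⊇ lo≤z (s≤s⁻¹ (≤-trans z<lo+k lo+k≤1+hi))

Unique⇒length≤ : ∀ {xs ys : List ℕ} → Unique xs → (∀ {z} → z ∈ xs → z ∈ ys) → length xs ≤ length ys
Unique⇒length≤ {[]} _ _ = z≤n
Unique⇒length≤ {x ∷ xs} (x∉xs ∷ xs-unique) xs⊆ys with ∈-∃++ (xs⊆ys (here refl))
... | ys₁ , ys₂ , refl = begin
  suc (length xs)               ≤⟨ s≤s (Unique⇒length≤ xs-unique xs⊆ys₁++ys₂) ⟩
  suc (length (ys₁ ++ ys₂))     ≡⟨ cong suc (length-++ ys₁) ⟩
  suc (length ys₁ + length ys₂) ≡⟨ +-suc (length ys₁) (length ys₂) ⟨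
  length ys₁ + length (x ∷ ys₂) ≡⟨ length-++ ys₁ ⟨
  length (ys₁ ++ x ∷ ys₂)       ∎
  where
  xs⊆ys₁++ys₂ : ∀ {z} → z ∈ xs → z ∈ ys₁ ++ ys₂
  xs⊆ys₁++ys₂ z∈xs with ∈-++⁻ ys₁ (xs⊆ys (there z∈xs))
  ... | inj₁ z∈ys₁          = ∈-++⁺ˡ z∈ys₁
  ... | inj₂ (here refl)    = ⊥-elim (All.lookup x∉xs z∈xs refl)
  ... | inj₂ (there z∈ys₂) = ∈-++⁺ʳ ys₁ z∈ys₂

card≤length : ∀ {xs ys} → (∀ {z} → z ∈ xs → z ∈ ys) → card xs ≤ length ys
card≤length {xs} xs⊆ys = Unique⇒length≤ (deduplicate-! xs) (xs⊆ys ∘ ∈-deduplicate⁻ _≟_ xs)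

length≤card : ∀ {xs ys} → Unique ys → (∀ {z} → z ∈ ys → z ∈ xs) → length ys ≤ card xs
length≤card ys-unique ys⊆xs = Unique⇒length≤ ys-unique (∈-deduplicate⁺ _≟_ ∘ ys⊆xs)

card-Unique : ∀ {xs} → Unique xs → card xs ≡ length xs
card-Unique {xs} xs-unique = ≤-antisym (card≤length {xs} id) (length≤card {xs} xs-unique id)

[m+n]∸[o+p]≡[m∸o]+[n∸p] : ∀ {m n o p} → o ≤ m → p ≤ n → (m + n) ∸ (o + p) ≡ (m ∸ o) + (n ∸ p)
[m+n]∸[o+p]≡[m∸o]+[n∸p] {m} {n} {o} {p} o≤m p≤n = begin-equality
  (m + n) ∸ (o + p) ≡⟨ ∸-+-assoc (m + n) o p ⟨
  (m + n) ∸ o ∸ p   ≡⟨ cong (_∸ p) (+-∸-comm n o≤m) ⟩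
  (m ∸ o + n) ∸ p   ≡⟨ +-∸-assoc (m ∸ o) p≤n ⟩
  (m ∸ o) + (n ∸ p) ∎

range∪mirror : ℕ → ℕ → ℕ → List ℕ → List ℕ
range∪mirror lo k M ts = range lo k ++ map (M ∸_) ts

length-range∪mirror : ∀ lo k M ts → length (range∪mirror lo k M ts) ≡ k + length ts
length-range∪mirror lo k M ts = begin-equality
  length (range lo k ++ map (M ∸_) ts)         ≡⟨ length-++ (range lo k) ⟩
  length (range lo k) + length (map (M ∸_) ts) ≡⟨ cong₂ _+_ (length-applyUpTo (lo +_) k) (length-map (M ∸_) ts) ⟩
  k + length ts                                ∎

mirror-unique : ∀ {M ts} → (∀ {t} → t ∈ ts → t ≤ M) → Unique ts → Unique (map (M ∸_) ts)
mirror-unique {ts = []}    _   []                     = []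
mirror-unique {ts = _ ∷ _} ≤M (t∉ts ∷ ts-unique) =
  All.map⁺ (All.tabulate λ t′∈ts → All.lookup t∉ts t′∈ts ∘ ∸-cancelˡ-≡ (≤M (here refl)) (≤M (there t′∈ts)))
  ∷ mirror-unique (≤M ∘ there) ts-unique

module _ (lo k M : ℕ) {ts : List ℕ} (above : ∀ {t} → t ∈ ts → lo + k + t ≤ M) where

  range-mirror-disjoint : Disjoint (range lo k) (map (M ∸_) ts)
  range-mirror-disjoint (z∈range , z∈mirror) with ∈-map⁻ (M ∸_) z∈mirror
  ... | t , t∈ts , refl =
    <-irrefl refl (m+n≤o⇒m≤o∸n (suc (M ∸ t)) (≤-trans (+-monoˡ-< t (proj₂ (∈-range⁻ z∈range))) (above t∈ts)))

  range∪mirror-unique : Unique ts → Unique (range∪mirror lo k M ts)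
  range∪mirror-unique ts-unique =
    ++⁺ (range-unique lo k)
        (mirror-unique (λ t∈ts → ≤-trans (m≤n+m _ (lo + k)) (above t∈ts)) ts-unique)
        range-mirror-disjoint

·-bounds : ∀ {A hi} → (∀ {a} → a ∈ A → 1 ≤ a × a ≤ hi) →
           ∀ n {x} → x ∈ suc n · A → suc n ≤ x × x ≤ suc n * hi
·-bounds {hi = hi} A-bounds zero x∈A with A-bounds x∈A
... | 1≤x , x≤hi = 1≤x , subst (_ ≤_) (sym (+-identityʳ hi)) x≤hi
·-bounds {A} A-bounds (suc n) x∈ with ⊕⁻ A (suc n · A) x∈
... | a , y , a∈A , y∈ , refl with A-bounds a∈A | ·-bounds A-bounds n y∈
...   | 1≤a , a≤hi | n≤y , y≤nhi = +-mono-≤ 1≤a n≤y , +-mono-≤ a≤hi y≤nhi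

card-·-≤ : ∀ {A K} → (∀ {a} → a ∈ A → 1 ≤ a × a ≤ suc K) → ∀ n → card (suc n · A) ≤ suc n * K + 1
card-·-≤ {A} {K} A-bounds n = begin
  card (suc n · A)                       ≤⟨ card≤length (λ x∈ → ∈-range⁺ (proj₁ (·-bounds A-bounds n x∈)) (x< x∈)) ⟩
  length (range (suc n) (suc n * K + 1)) ≡⟨ length-applyUpTo (suc n +_) (suc n * K + 1) ⟩
  suc n * K + 1                          ∎
  where
  x< : ∀ {x} → x ∈ suc n · A → x < suc n + (suc n * K + 1)
  x< x∈ = ≤-trans (s≤s (proj₂ (·-bounds A-bounds n x∈))) (≤-reflexive (eq n K))
    where
    eq : ∀ n K → suc (suc n * suc K) ≡ suc n + (suc n * K + 1)
    eq = solve-∀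

·-mirror : ∀ {A T F} → (∀ {t} → t ∈ T → t ≤ F × F ∸ t ∈ A) →
           ∀ n {t} → t ∈ suc n · T → t ≤ suc n * F × suc n * F ∸ t ∈ suc n · A
·-mirror {A} {F = F} mirror zero {t} t∈T with mirror t∈T
... | t≤F , F∸t∈A = subst (t ≤_) F≡1*F t≤F , subst (λ M → M ∸ t ∈ A) F≡1*F F∸t∈A
  where F≡1*F = sym (+-identityʳ F)
·-mirror {A} {T} mirror (suc n) t∈ with ⊕⁻ T (suc n · T) t∈
... | t₀ , t , t₀∈T , t∈′ , refl with mirror t₀∈T | ·-mirror mirror n t∈′
...   | t₀≤F , F∸t₀∈A | t≤nF , nF∸t∈ =
  +-mono-≤ t₀≤F t≤nF ,
  subst (_∈ A ⊕ (suc n · A)) (sym ([m+n]∸[o+p]≡[m∸o]+[n∸p] t₀≤F t≤nF)) (⊕⁺ F∸t₀∈A nF∸t∈)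

·-⊇[] : ∀ {A m K} → 1 ≤ m → K ≤ m + m → A ⊇[ 1 , m ] → A ⊇[ K , suc K ] →
        ∀ n → suc n · A ⊇[ suc n , n * suc K + m ]
·-⊇[] _ _ A⊇low _ zero = A⊇low
·-⊇[] {A} {m} {K} 1≤m K≤2m A⊇low A⊇high (suc n) =
  ⊇[]-join adjacent (⊕-⊇[] 1≤m nonempty A⊇low IH)
    (subst (λ hi → A ⊕ (suc n · A) ⊇[ K + suc n , hi ]) (sym (+-assoc (suc K) (n * suc K) m))
      (⊕-⊇[] (n≤1+n K) nonempty A⊇high IH))
  where
  IH = ·-⊇[] 1≤m K≤2m A⊇low A⊇high n
  nonempty : suc n ≤ n * suc K + m
  nonempty = subst (_≤ n * suc K + m) (+-comm n 1) (+-mono-≤ (m≤m*n n (suc K)) 1≤m)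
  adjacent : K + suc n ≤ suc (m + (n * suc K + m))
  adjacent = begin
    K + suc n                 ≤⟨ +-monoˡ-≤ (suc n) K≤2m ⟩
    m + m + suc n             ≡⟨ +-suc (m + m) n ⟩
    suc (m + m + n)           ≡⟨ cong suc (+-assoc m m n) ⟩
    suc (m + (m + n))         ≡⟨ cong (λ x → suc (m + x)) (+-comm m n) ⟩
    suc (m + (n + m))         ≤⟨ s≤s (+-monoʳ-≤ m (+-monoˡ-≤ m (m≤m*n n (suc K)))) ⟩
    suc (m + (n * suc K + m)) ∎

T₀ : List ℕ
T₀ = 0 ∷ 1 ∷ 5 ∷ 7 ∷ []

T₀-≤7 : ∀ {t} → t ∈ T₀ → t ≤ 7
T₀-≤7 = All.lookup (from-yes (All.all? (_≤? 7) T₀))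

T₀-unique : Unique T₀
T₀-unique = from-yes (unique? T₀)

4·T₀⊇[0,21] : 4 · T₀ ⊇[ 0 , 21 ]
4·T₀⊇[0,21] _ z≤21 = All.lookup (from-yes (All.all? (_∈? 4 · T₀) (upTo 22))) (∈-upTo⁺ (s≤s z≤21))

·T₀-⊇[] : ∀ k → (4 + k) · T₀ ⊇[ 0 , 21 + 6 * k ]
·T₀-⊇[] zero    = 4·T₀⊇[0,21]
·T₀-⊇[] (suc k) = ⊇[]-weakenʳ (≤-trans (n≤1+n _) (≤-reflexive (eq k)))
  (⊇[]-join 7≤ (⊕-⊇[] ≤-refl z≤n (⊇[]-singleton {T₀} (here refl)) (·T₀-⊇[] k))
               (⊕-⊇[] ≤-refl z≤n (⊇[]-singleton {T₀} 7∈T₀) (·T₀-⊇[] k)))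
  where
  7∈T₀ : 7 ∈ T₀
  7∈T₀ = there (there (there (here refl)))
  7≤ : 7 ≤ suc (21 + 6 * k)
  7≤ = s≤s (≤-trans (m≤m+n 6 15) (m≤m+n 21 (6 * k)))
  eq : ∀ k → suc (21 + 6 * suc k) ≡ 7 + (21 + 6 * k)
  eq = solve-∀

tops : ℕ → List ℕ
tops N = filter (_≤? 6 * N + 2) (deduplicate _≟_ (N · T₀))

tops-unique : ∀ N → Unique (tops N)
tops-unique N = filter⁺ (_≤? 6 * N + 2) (deduplicate-! (N · T₀))

∈-tops⁻ : ∀ {N t} → t ∈ tops N → t ∈ N · T₀ × t ≤ 6 * N + 2
∈-tops⁻ {N} t∈ = Product.map₁ (∈-deduplicate⁻ _≟_ (N · T₀)) (∈-filter⁻ (_≤? 6 * N + 2) t∈)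

∈-tops⁺ : ∀ {N t} → t ∈ N · T₀ → t ≤ 6 * N + 2 → t ∈ tops N
∈-tops⁺ {N} t∈ t≤ = ∈-filter⁺ (_≤? 6 * N + 2) (∈-deduplicate⁺ _≟_ t∈) t≤

length-tops : ∀ n → 6 * n + 10 ≤ length (tops (2 + n))
length-tops 0 = from-yes (10 ≤? length (tops 2))
length-tops 1 = from-yes (16 ≤? length (tops 3))
length-tops (suc (suc k)) = begin
  6 * suc (suc k) + 10       ≡⟨ eq₁ k ⟩
  22 + 6 * k                 ≡⟨ length-upTo (22 + 6 * k) ⟨
  length (upTo (22 + 6 * k)) ≤⟨ Unique⇒length≤ (upTo⁺ (22 + 6 * k)) upTo⊆tops ⟩
  length (tops (4 + k))      ∎
  where
  eq₁ : ∀ k → 6 * suc (suc k) + 10 ≡ 22 + 6 * k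
  eq₁ = solve-∀
  eq₂ : ∀ k → 6 * (4 + k) + 2 ≡ 5 + (21 + 6 * k)
  eq₂ = solve-∀
  upTo⊆tops : ∀ {t} → t ∈ upTo (22 + 6 * k) → t ∈ tops (4 + k)
  upTo⊆tops t∈ =
    ∈-tops⁺ {4 + k} (·T₀-⊇[] k z≤n t≤) (≤-trans t≤ (≤-trans (m≤n+m _ 5) (≤-reflexive (sym (eq₂ k)))))
    where t≤ = s≤s⁻¹ (∈-upTo⁻ t∈)

semigroupWithGaps : (G : List ℕ) (m : ℕ) → G ⊇[ 1 , m ] →
                    (∀ {g} → g ∈ G → 1 ≤ g × g ≤ suc (m + m)) → NumericalSemigroup
semigroupWithGaps G m G⊇[1,m] G-bounds = record
  { S         = _∉ G
  ; zero∈S    = λ 0∈G → <-irrefl refl (proj₁ (G-bounds 0∈G))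
  ; closed    = closed
  ; gaps      = G
  ; gaps-spec = λ z → mk⇔ (decidable-stable (z ∈? G)) (λ z∈G z∉G → z∉G z∈G)
  }
  where
  zero-or-large : ∀ {x} → x ∉ G → x ≡ 0 ⊎ m < x
  zero-or-large {zero}  _   = inj₁ refl
  zero-or-large {suc x} x∉G with suc x ≤? m
  ... | yes x<m = ⊥-elim (x∉G (G⊇[1,m] (s≤s z≤n) x<m))
  ... | no  x≮m = inj₂ (≰⇒> x≮m)

  closed : ∀ {x y} → x ∉ G → y ∉ G → x + y ∉ G
  closed {x} {y} x∉G y∉G with zero-or-large x∉G | zero-or-large y∉G
  ... | inj₁ refl | _         = y∉G
  ... | inj₂ _    | inj₁ refl = subst (_∉ G) (sym (+-identityʳ x)) x∉G
  ... | inj₂ m<x  | inj₂ m<y  = λ x+y∈G → <⇒≱ F<x+y (proj₂ (G-bounds x+y∈G))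
    where
    F<x+y : suc (m + m) < x + y
    F<x+y = subst (_≤ x + y) (cong suc (+-suc m m)) (+-mono-≤ m<x m<y)

InBuchweitz-suc⇔ : ∀ S {k} → card (NumericalSemigroup.gaps S) ≡ suc k → ∀ n →
  InBuchweitz S (suc n) ⇔ (1 ≤ n × suc (2 * n) * k < card (suc n · NumericalSemigroup.gaps S))
InBuchweitz-suc⇔ S {k} |G|≡1+k n =
  mk⇔ (Product.map s≤s⁻¹ (ℤ.drop‿+<+ ∘ subst (ℤ._< ℤ.+ L) lhs≡))
      (Product.map s≤s (subst (ℤ._< ℤ.+ L) (sym lhs≡) ∘ ℤ.+<+))
  where
  G = NumericalSemigroup.gaps S
  L = card (suc n · G)
  lhs≡ : ℤ.+ (2 * suc n ∸ 1) ℤ.* (ℤ.+ card G ℤ.- ℤ.+ 1) ≡ ℤ.+ (suc (2 * n) * k)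
  -- 2 * suc n ∸ 1 evaluates to n + suc (n + 0)
  lhs≡ = trans (cong₂ (λ a g → ℤ.+ a ℤ.* (ℤ.+ g ℤ.- ℤ.+ 1)) (+-suc n (n + 0)) |G|≡1+k)
               (sym (ℤ.pos-* (suc (2 * n)) k))

gaps : ℕ → List ℕ
gaps m = range∪mirror 1 m (suc (m + m)) T₀

module Gaps (m : ℕ) (7≤m : 7 ≤ m) where

  T₀-above : ∀ {t} → t ∈ T₀ → 1 + m + t ≤ suc (m + m)
  T₀-above t∈T₀ = s≤s (+-monoʳ-≤ m (≤-trans (T₀-≤7 t∈T₀) 7≤m))

  card-gaps : card (gaps m) ≡ suc (m + 3)
  card-gaps = begin-equality
    card (gaps m)   ≡⟨ card-Unique (range∪mirror-unique 1 m (suc (m + m)) T₀-above T₀-unique) ⟩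
    length (gaps m) ≡⟨ length-range∪mirror 1 m (suc (m + m)) T₀ ⟩
    m + 4           ≡⟨ +-suc m 3 ⟩
    suc (m + 3)     ∎

  gaps-bounds : ∀ {g} → g ∈ gaps m → 1 ≤ g × g ≤ suc (m + m)
  gaps-bounds g∈gaps with ∈-++⁻ (range 1 m) {map (suc (m + m) ∸_) T₀} g∈gaps
  ... | inj₁ g∈range =
    let 1≤g , g<1+m = ∈-range⁻ g∈range in 1≤g , ≤-trans (s≤s⁻¹ g<1+m) (≤-trans (m≤m+n m m) (n≤1+n _))
  ... | inj₂ g∈mirror with ∈-map⁻ (suc (m + m) ∸_) {xs = T₀} g∈mirror
  ...   | t , t∈T₀ , refl = ≤-trans (s≤s z≤n) (m+n≤o⇒m≤o∸n (suc m) (T₀-above t∈T₀)) , m∸n≤m _ t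

  mirror∈gaps : ∀ {t} → t ∈ T₀ → t ≤ suc (m + m) × suc (m + m) ∸ t ∈ gaps m
  mirror∈gaps t∈T₀ =
    ≤-trans (m≤n+m _ (1 + m)) (T₀-above t∈T₀) , ∈-++⁺ʳ (range 1 m) (∈-map⁺ (suc (m + m) ∸_) t∈T₀)

  gaps⊇[1,m] : gaps m ⊇[ 1 , m ]
  gaps⊇[1,m] 1≤z z≤m = ∈-++⁺ˡ (∈-range⁺ 1≤z (s≤s z≤m))

  gaps⊇[2m,2m+1] : gaps m ⊇[ m + m , suc (m + m) ]
  gaps⊇[2m,2m+1] = ⊇[]-join ≤-refl (⊇[]-singleton {gaps m} (proj₂ (mirror∈gaps (there (here refl)))))
                                    (⊇[]-singleton {gaps m} (proj₂ (mirror∈gaps (here refl))))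

  semigroup : NumericalSemigroup
  semigroup = semigroupWithGaps (gaps m) m gaps⊇[1,m] gaps-bounds

  card-·gaps-≤ : ∀ n → m ≤ 6 * n + 2 → card (suc n · gaps m) ≤ suc (2 * n) * (m + 3)
  card-·gaps-≤ n m≤6n+2 = begin
    card (suc n · gaps m)             ≤⟨ card-·-≤ gaps-bounds n ⟩
    suc n * (m + m) + 1               ≡⟨ eq₁ n m ⟩
    suc (2 * n) * m + (m + 1)         ≤⟨ +-monoʳ-≤ (suc (2 * n) * m) (+-monoˡ-≤ 1 m≤6n+2) ⟩
    suc (2 * n) * m + (6 * n + 2 + 1) ≡⟨ eq₂ n m ⟨
    suc (2 * n) * (m + 3)             ∎
    where
    eq₁ : ∀ n m → suc n * (m + m) + 1 ≡ suc (2 * n) * m + (m + 1)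
    eq₁ = solve-∀
    eq₂ : ∀ n m → suc (2 * n) * (m + 3) ≡ suc (2 * n) * m + (6 * n + 2 + 1)
    eq₂ = solve-∀

  card-·gaps-> : ∀ n → 1 ≤ n → 6 * suc n + 2 ≤ m → suc (2 * n) * (m + 3) < card (suc n · gaps m)
  card-·gaps-> n@(suc n′) _ 6N+2≤m = begin
    suc (suc (2 * n) * (m + 3)) ≡⟨ eq₁ n′ m ⟩
    k + (6 * n′ + 10)           ≤⟨ +-monoʳ-≤ k (length-tops n′) ⟩
    k + length (tops (suc n))   ≡⟨ length-range∪mirror (suc n) k M (tops (suc n)) ⟨
    length witness              ≤⟨ length≤card (range∪mirror-unique (suc n) k M above (tops-unique (suc n))) witness⊆ ⟩
    card (suc n · gaps m)       ∎
    where
    k = n * (m + m) + m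
    M = suc n * suc (m + m)
    witness = range∪mirror (suc n) k M (tops (suc n))
    eq₁ : ∀ n′ m → suc (suc (2 * suc n′) * (m + 3)) ≡ suc n′ * (m + m) + m + (6 * n′ + 10)
    eq₁ = solve-∀
    eq₂ : ∀ n m → suc n + (n * (m + m) + m) + m ≡ suc n * suc (m + m)
    eq₂ = solve-∀
    eq₃ : ∀ n m → suc n + (n * (m + m) + m) ≡ suc (n * suc (m + m) + m)
    eq₃ = solve-∀
    above : ∀ {t} → t ∈ tops (suc n) → suc n + k + t ≤ M
    above t∈ =
      ≤-trans (+-monoʳ-≤ (suc n + k) (≤-trans (proj₂ (∈-tops⁻ {suc n} t∈)) 6N+2≤m)) (≤-reflexive (eq₂ n m))
    witness⊆ : ∀ {z} → z ∈ witness → z ∈ suc n · gaps m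
    witness⊆ z∈ with ∈-++⁻ (range (suc n) k) z∈
    ... | inj₁ z∈range =
      range-⊆ (·-⊇[] (≤-trans (s≤s z≤n) 7≤m) ≤-refl gaps⊇[1,m] gaps⊇[2m,2m+1] n)
              (≤-reflexive (eq₃ n m)) z∈range
    ... | inj₂ z∈mirror with ∈-map⁻ (M ∸_) z∈mirror
    ...   | t , t∈ , refl = proj₂ (·-mirror mirror∈gaps n (proj₁ (∈-tops⁻ {suc n} t∈)))

proposition3p4 : ∀ (b : ℕ) → 3 ≤ b →
    Σ NumericalSemigroup (λ S → ∀ n → InBuchweitz S n ⇔ (2 ≤ n × n ≤ b))
proposition3p4 b 3≤b = semigroup , B⇔
  where
  m = 6 * b + 2
  6x+2-mono : ∀ {x y} → x ≤ y → 6 * x + 2 ≤ 6 * y + 2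
  6x+2-mono x≤y = +-monoˡ-≤ 2 (*-monoʳ-≤ 6 x≤y)
  open Gaps m (≤-trans (n≤1+n 7) (6x+2-mono {1} (≤-trans (s≤s z≤n) 3≤b)))
  B⇔ : ∀ n → InBuchweitz semigroup n ⇔ (2 ≤ n × n ≤ b)
  B⇔ zero    = mk⇔ (λ { (() , _) }) (λ { (() , _) })
  B⇔ (suc n) = mk⇔ to from ⇔-∘ InBuchweitz-suc⇔ semigroup card-gaps n
    where
    to : 1 ≤ n × suc (2 * n) * (m + 3) < card (suc n · gaps m) → 2 ≤ suc n × suc n ≤ b
    to (1≤n , B) = s≤s 1≤n , ≰⇒> (λ b≤n → <⇒≱ B (card-·gaps-≤ n (6x+2-mono b≤n)))
    from : 2 ≤ suc n × suc n ≤ b → 1 ≤ n × suc (2 * n) * (m + 3) < card (suc n · gaps m)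
    from (s≤s 1≤n , N≤b) = 1≤n , card-·gaps-> n 1≤n (6x+2-mono N≤b)
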